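{- As $\mathbb{L}$-species, $\mathrm{Cay}(21) = 1 + \int E^2 = E_{\mathrm{even}}\cdot E$.
   Context: A Cayley permutation of length $n$ is a word $w_1\cdots w_n$ of positive integers with $\{w_1,\dots,w_n\}=[k]$ for some $k\le n$; it avoids $21$ if there are no $i<j$ with $w_i>w_j$. An $\mathbb{L}$-species assigns to each finite totally ordered set a finite set of structures, functorially in order-preserving bijections; isomorphic $\mathbb{L}$-species (equivalently, ones with equally many structures on each $n$-element set) are written as equal. $\mathrm{Cay}(21)$ is the $\mathbb{L}$-species of $21$-avoiding Cayley permutations. $1$ is the species with one structure on the empty set and none otherwise; $E$ has one structure on every set; $E_{\mathrm{even}}$ has one structure on each set of even cardinality and none otherwise. Sum is disjoint union; product $(F\cdot G)[\ell]=\bigsqcup_{\ell=\ell_1\sqcup\ell_2}F[\ell_1]\times G[\ell_2]$ over ordered pairs of complementary subsets; $F^2=F\cdot F$. Integral: $(\int F)[\emptyset]=\emptyset$ and $(\int F)[\ell]=F[\ell\setminus\{\min\ell\}]$ for $\ell\ne\emptyset$. -}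

module Defs where

open import Data.Nat using (ℕ; zero; suc; _≤_; _∸_)
import Data.Nat as ℕ
open import Data.Fin using (Fin)
import Data.Fin as Fin
open import Data.Fin.Subset using (Subset; ∣_∣)
open import Data.Vec using (Vec; lookup)
open import Data.Product using (Σ; ∃; _×_)
open import Data.Sum using (_⊎_)
open import Data.Unit using (⊤)
open import Data.Empty using (⊥)
open import Relation.Nullary using (¬_)
open import Relation.Binary.PropositionalEquality using (_≡_)
open import Function.Bundles using (_↔_)

-- An L-species: since every n-element totally ordered set is uniquely
-- order-isomorphic to [n] = Fin n, an L-species is determined (up to
-- isomorphism) by its sets of structures on [n] for each n.
LSpecies : Set₁
LSpecies = ℕ → Set

-- Isomorphism of L-species: a bijection of structures on [n] for every n
-- (naturality is automatic, the only order-automorphism of [n] being id).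
infix 4 _≅_
_≅_ : LSpecies → LSpecies → Set
F ≅ G = ∀ n → F n ↔ G n

𝟏 : LSpecies
𝟏 zero    = ⊤
𝟏 (suc n) = ⊥

E : LSpecies
E n = ⊤

Eeven : LSpecies
Eeven zero          = ⊤
Eeven (suc zero)    = ⊥
Eeven (suc (suc n)) = Eeven n

infixl 6 _⊕_
_⊕_ : LSpecies → LSpecies → LSpecies
(F ⊕ G) n = F n ⊎ G n

-- Product: sum over ordered decompositions [n] = ℓ₁ ⊔ ℓ₂, ℓ₁ given as a
-- subset S of [n] and ℓ₂ its complement; structures on ℓ₁ (resp. ℓ₂) are
-- transported along the unique order-isomorphism with [|ℓ₁|] (resp. [n - |ℓ₁|]).
infixl 7 _·_
_·_ : LSpecies → LSpecies → LSpecies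
(F · G) n = Σ (Subset n) λ S → F ∣ S ∣ × G (n ∸ ∣ S ∣)

-- Integral: (∫F)[∅] = ∅, (∫F)[ℓ] = F[ℓ ∖ {min ℓ}].
∫ : LSpecies → LSpecies
∫ F zero    = ⊥
∫ F (suc n) = F n

IsCayley : ∀ {n} → Vec ℕ n → Set
IsCayley {n} w =
  Σ ℕ λ k → k ≤ n
    × (∀ i → 1 ≤ lookup w i × lookup w i ≤ k)
    × (∀ j → 1 ≤ j → j ≤ k → ∃ λ i → lookup w i ≡ j)

Avoids21 : ∀ {n} → Vec ℕ n → Set
Avoids21 w = ∀ i j → i Fin.< j → ¬ (lookup w j ℕ.< lookup w i)

-- Cay(21): structures on [n] are the 21-avoiding Cayley permutations of
-- length n.  The property proofs are irrelevant fields, so a structure is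
-- determined by its word alone.
record Cay21Str (n : ℕ) : Set where
  constructor cay
  field
    word     : Vec ℕ n
    .cayley  : IsCayley word
    .avoids  : Avoids21 word

Cay21 : LSpecies
Cay21 = Cay21Str

-- A 21-avoiding word is weakly increasing, so a 21-avoiding Cayley permutation
-- of length n + 1 starts with 1 and each later letter equals its predecessor
-- or exceeds it by one; recording which letters rise is a bijection with the
-- subsets of an n-set, that is with (∫ (E · E))[n + 1].  On the other side, an
-- even subset of [n + 1] is determined by its trace on the last n points, the
-- first point being added exactly when that trace is odd.
module Submission where

open import Defs
open import Data.Bool using (Bool; true; false; not)
open import Data.Fin using (zero; suc)
open import Data.Fin.Subset using (Subset; ∣_∣)
open import Data.Fin.Subset.Properties using (∣p∣≤n)
open import Data.Nat using (ℕ; zero; suc; _+_; _≤_; _<_; z≤n; s≤s; _≟_; _≤?_; _<?_)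
open import Data.Nat.Properties
  using (≤-refl; ≤-trans; ≤-antisym; ≤-<-trans; <-irrefl; <⇒≢; <⇒≱; ≮⇒≥; ≰⇒>; ≤∧≢⇒<;
         n≤1+n; n<1+n; m≤n⇒m≤1+n; m≤n⇒m<n∨m≡n; m≤m+n; +-suc; +-identityʳ)
open import Data.Product using (∃; _×_; _,_; proj₁; proj₂)
open import Data.Sum using (inj₁; inj₂)
open import Data.Sum.Function.Propositional using (_⊎-↔_)
open import Data.Unit using (⊤; tt)
open import Data.Vec using (Vec; []; _∷_; lookup; tail)
open import Data.Vec.Properties using (≡-dec)
open import Function.Base using (_∘_)
open import Function.Bundles using (_↔_; mk↔ₛ′)
open import Function.Properties.Inverse using (↔-refl; ↔-sym; ↔-trans)
open import Relation.Nullary using (¬_; Dec; yes; no; does; contradiction)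
open import Relation.Nullary.Decidable using (recompute; dec-true; dec-false)
open import Relation.Binary.PropositionalEquality
  using (_≡_; refl; sym; cong; cong₂; subst)

≅-refl : ∀ {F} → F ≅ F
≅-refl n = ↔-refl

≅-sym : ∀ {F G} → F ≅ G → G ≅ F
≅-sym F≅G n = ↔-sym (F≅G n)

≅-trans : ∀ {F G H} → F ≅ G → G ≅ H → F ≅ H
≅-trans F≅G G≅H n = ↔-trans (F≅G n) (G≅H n)

⊕-cong : ∀ {F F′ G G′} → F ≅ F′ → G ≅ G′ → F ⊕ G ≅ F′ ⊕ G′
⊕-cong F≅F′ G≅G′ n = F≅F′ n ⊎-↔ G≅G′ n

∫-cong : ∀ {F G} → F ≅ G → ∫ F ≅ ∫ G
∫-cong F≅G zero    = ↔-refl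
∫-cong F≅G (suc n) = F≅G n

℘ : LSpecies
℘ = Subset

E·E≅℘ : E · E ≅ ℘
E·E≅℘ n = mk↔ₛ′ proj₁ (λ S → S , tt , tt) (λ _ → refl) (λ _ → refl)

≅-𝟏⊕∫ : ∀ {F G} → F 0 ↔ ⊤ → (∀ n → F (suc n) ↔ G n) → F ≅ 𝟏 ⊕ ∫ G
≅-𝟏⊕∫ F₀ F₊ zero    = ↔-trans F₀ (mk↔ₛ′ inj₁ (λ _ → tt) (λ { (inj₁ tt) → refl ; (inj₂ ()) }) (λ _ → refl))
≅-𝟏⊕∫ F₀ F₊ (suc n) = ↔-trans (F₊ n) (mk↔ₛ′ inj₂ (λ { (inj₁ ()) ; (inj₂ S) → S })
  (λ { (inj₁ ()) ; (inj₂ _) → refl }) (λ _ → refl))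

step : ℕ → Bool → ℕ
step a false = a
step a true  = suc a

staircase : ∀ {n} → ℕ → Subset n → Vec ℕ n
staircase a []       = []
staircase a (b ∷ bs) = step a b ∷ staircase (step a b) bs

risers : ∀ {n} → ℕ → Vec ℕ n → Subset n
risers a []       = []
risers a (x ∷ xs) = does (a <? x) ∷ risers x xs

Covers : ∀ {n} → ℕ → ℕ → Vec ℕ n → Set
Covers a k xs = ∀ j → a < j → j ≤ k → ∃ λ i → lookup xs i ≡ j

step-≥ : ∀ a b → a ≤ step a b
step-≥ a false = ≤-refl
step-≥ a true  = n≤1+n a

step-≤ : ∀ a b → step a b ≤ suc a
step-≤ a false = n≤1+n a
step-≤ a true  = ≤-refl

step-+-∣∣ : ∀ a b {n} (bs : Subset n) → step a b + ∣ bs ∣ ≡ a + ∣ b ∷ bs ∣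
step-+-∣∣ a false bs = refl
step-+-∣∣ a true  bs = sym (+-suc a ∣ bs ∣)

does-<?-step : ∀ a b → does (a <? step a b) ≡ b
does-<?-step a false = dec-false (a <? a) (<-irrefl refl)
does-<?-step a true  = dec-true (a <? suc a) (n<1+n a)

step-does-<? : ∀ {a x} → a ≤ x → x ≤ suc a → step a (does (a <? x)) ≡ x
step-does-<? {a} a≤x x≤1+a with m≤n⇒m<n∨m≡n a≤x
... | inj₂ refl = cong (step a) (does-<?-step a false)
... | inj₁ a<x rewrite ≤-antisym x≤1+a a<x = cong (step a) (does-<?-step a true)

staircase-≥ : ∀ {n} a (bs : Subset n) i → a ≤ lookup (staircase a bs) i
staircase-≥ a (b ∷ bs) zero    = step-≥ a b
staircase-≥ a (b ∷ bs) (suc i) = ≤-trans (step-≥ a b) (staircase-≥ (step a b) bs i)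

staircase-≤ : ∀ {n} a (bs : Subset n) i → lookup (staircase a bs) i ≤ a + ∣ bs ∣
staircase-≤ a (b ∷ bs) i = subst (lookup (staircase a (b ∷ bs)) i ≤_) (step-+-∣∣ a b bs) (bound i)
  where
  bound : ∀ i → lookup (staircase a (b ∷ bs)) i ≤ step a b + ∣ bs ∣
  bound zero    = m≤m+n (step a b) ∣ bs ∣
  bound (suc i) = staircase-≤ (step a b) bs i

staircase-covers : ∀ {n} a (bs : Subset n) j → a ≤ j → j ≤ a + ∣ bs ∣ →
                   ∃ λ i → lookup (a ∷ staircase a bs) i ≡ j
staircase-covers a []       j a≤j j≤a+0 = zero , ≤-antisym a≤j (subst (j ≤_) (+-identityʳ a) j≤a+0)
staircase-covers a (b ∷ bs) j a≤j j≤a+∣bs∣ with j ≟ a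
... | yes refl = zero , refl
... | no  j≢a  with staircase-covers (step a b) bs j
                      (≤-trans (step-≤ a b) (≤∧≢⇒< a≤j (j≢a ∘ sym)))
                      (subst (j ≤_) (sym (step-+-∣∣ a b bs)) j≤a+∣bs∣)
...   | i , e = suc i , e

head-minimal : ∀ {n x} {xs : Vec ℕ n} → Avoids21 (x ∷ xs) → ∀ i → x ≤ lookup (x ∷ xs) i
head-minimal av zero    = ≤-refl
head-minimal av (suc i) = ≮⇒≥ (av zero (suc i) (s≤s z≤n))

avoids21-tail : ∀ {n x} {xs : Vec ℕ n} → Avoids21 (x ∷ xs) → Avoids21 xs
avoids21-tail av i j i<j = av (suc i) (suc j) (s≤s i<j)

∷-avoids21 : ∀ {n x} {xs : Vec ℕ n} → (∀ i → x ≤ lookup xs i) → Avoids21 xs → Avoids21 (x ∷ xs)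
∷-avoids21 x≤xs av zero    (suc j) _         xⱼ<x = <⇒≱ xⱼ<x (x≤xs j)
∷-avoids21 x≤xs av (suc i) (suc j) (s≤s i<j) = av i j i<j

staircase-avoids21 : ∀ {n} a (bs : Subset n) → Avoids21 (a ∷ staircase a bs)
staircase-avoids21 a []       = ∷-avoids21 (λ ()) (λ ())
staircase-avoids21 a (b ∷ bs) = ∷-avoids21 (staircase-≥ a (b ∷ bs)) (staircase-avoids21 (step a b) bs)

covers-tail : ∀ {n a k x} {xs : Vec ℕ n} → a ≤ x → Covers a k (x ∷ xs) → Covers x k xs
covers-tail a≤x covers j x<j j≤k with covers j (≤-<-trans a≤x x<j) j≤k
... | zero  , x≡j = contradiction x≡j (<⇒≢ x<j)
... | suc i , e   = i , e

-- The first letter is minimal, and suc a is a letter unless the word stays at or below a.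
head-≤-suc : ∀ {n a k x} {xs : Vec ℕ n} →
             Covers a k (x ∷ xs) → Avoids21 (x ∷ xs) → x ≤ k → x ≤ suc a
head-≤-suc {a = a} {x = x} covers av x≤k with x ≤? a
... | yes x≤a = m≤n⇒m≤1+n x≤a
... | no  x≰a with covers (suc a) (n<1+n a) (≤-trans (≰⇒> x≰a) x≤k)
...   | i , e = subst (x ≤_) e (head-minimal av i)

staircase-risers : ∀ {n} a k (xs : Vec ℕ n) →
                   (∀ i → a ≤ lookup xs i) → (∀ i → lookup xs i ≤ k) →
                   Covers a k xs → Avoids21 xs → staircase a (risers a xs) ≡ xs
staircase-risers a k []       _     _     _      _  = refl
staircase-risers a k (x ∷ xs) above below covers av
  rewrite step-does-<? (above zero) (head-≤-suc covers av (below zero)) =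
  cong (x ∷_) (staircase-risers x k xs (head-minimal av ∘ suc) (below ∘ suc)
                                 (covers-tail (above zero) covers) (avoids21-tail av))

risers-staircase : ∀ {n} a (bs : Subset n) → risers a (staircase a bs) ≡ bs
risers-staircase a []       = refl
risers-staircase a (b ∷ bs) = cong₂ _∷_ (does-<?-step a b) (risers-staircase (step a b) bs)

staircase-isCayley : ∀ {n} (bs : Subset n) → IsCayley (1 ∷ staircase 1 bs)
staircase-isCayley bs = suc ∣ bs ∣ , s≤s (∣p∣≤n bs) , bounds , staircase-covers 1 bs
  where
  bounds : ∀ i → 1 ≤ lookup (1 ∷ staircase 1 bs) i × lookup (1 ∷ staircase 1 bs) i ≤ suc ∣ bs ∣
  bounds zero    = ≤-refl , s≤s z≤n
  bounds (suc i) = staircase-≥ 1 bs i , staircase-≤ 1 bs i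

-- The surjectivity clause of IsCayley w is definitionally Covers 0 k w.
cayley-staircase : ∀ {n} (w : Vec ℕ (suc n)) → IsCayley w → Avoids21 w →
                   1 ∷ staircase 1 (risers 1 (tail w)) ≡ w
cayley-staircase (x ∷ xs) (k , _ , bounds , covers) av =
  cong₂ _∷_ (sym x≡1)
    (staircase-risers 1 k xs (λ i → subst (_≤ lookup xs i) x≡1 (head-minimal av (suc i)))
      (proj₂ ∘ bounds ∘ suc) (subst (λ a → Covers a k xs) x≡1 (covers-tail z≤n covers))
      (avoids21-tail av))
  where
  x≡1 : x ≡ 1
  x≡1 = ≤-antisym (head-≤-suc covers av (proj₂ (bounds zero))) (proj₁ (bounds zero))

word-injective : ∀ {n} {c c′ : Cay21 n} → Cay21Str.word c ≡ Cay21Str.word c′ → c ≡ c′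
word-injective {c = cay w _ _} {cay .w _ _} refl = refl

cay21-zero : Cay21 0 ↔ ⊤
cay21-zero = mk↔ₛ′ (λ _ → tt) (λ _ → cay [] empty-isCayley (λ ())) (λ _ → refl) (λ { (cay [] _ _) → refl })
  where
  empty-isCayley : IsCayley []
  empty-isCayley = 0 , z≤n , (λ ()) , λ j 1≤j j≤0 → contradiction (≤-trans 1≤j j≤0) λ ()

cay21-suc : ∀ n → Cay21 (suc n) ↔ Subset n
cay21-suc n = mk↔ₛ′ toRisers fromRisers (risers-staircase 1) (λ c → word-injective (staircase-risers-word c))
  where
  toRisers : Cay21 (suc n) → Subset n
  toRisers c = risers 1 (tail (Cay21Str.word c))
  fromRisers : Subset n → Cay21 (suc n)
  fromRisers bs = cay (1 ∷ staircase 1 bs) (staircase-isCayley bs) (staircase-avoids21 1 bs)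
  -- The Cayley and avoidance proofs are irrelevant, so the equation is recomputed from its decision.
  staircase-risers-word : ∀ c → Cay21Str.word (fromRisers (toRisers c)) ≡ Cay21Str.word c
  staircase-risers-word (cay w isC av) = recompute (≡-dec _≟_ _ w) (cayley-staircase w isC av)

Eeven? : ∀ n → Dec (Eeven n)
Eeven? zero          = yes tt
Eeven? (suc zero)    = no λ ()
Eeven? (suc (suc n)) = Eeven? n

Eeven-irrelevant : ∀ n (p q : Eeven n) → p ≡ q
Eeven-irrelevant zero          tt tt = refl
Eeven-irrelevant (suc (suc n)) p  q  = Eeven-irrelevant n p q

Eeven-suc⇒¬Eeven : ∀ n → Eeven (suc n) → ¬ Eeven n
Eeven-suc⇒¬Eeven (suc zero)    _ ()
Eeven-suc⇒¬Eeven (suc (suc n)) p q = Eeven-suc⇒¬Eeven n p q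

¬Eeven⇒Eeven-suc : ∀ n → ¬ Eeven n → Eeven (suc n)
¬Eeven⇒Eeven-suc zero          ¬p = contradiction tt ¬p
¬Eeven⇒Eeven-suc (suc zero)    ¬p = tt
¬Eeven⇒Eeven-suc (suc (suc n)) ¬p = ¬Eeven⇒Eeven-suc n ¬p

parityBit : ∀ {n} → Subset n → Bool
parityBit bs = not (does (Eeven? ∣ bs ∣))

parityBit-Eeven : ∀ {n} (bs : Subset n) → Eeven ∣ parityBit bs ∷ bs ∣
parityBit-Eeven bs with Eeven? ∣ bs ∣
... | yes even = even
... | no  odd  = ¬Eeven⇒Eeven-suc ∣ bs ∣ odd

parityBit-unique : ∀ {n} b (bs : Subset n) → Eeven ∣ b ∷ bs ∣ → parityBit bs ≡ b
parityBit-unique true  bs even with Eeven? ∣ bs ∣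
... | yes even′ = contradiction even′ (Eeven-suc⇒¬Eeven ∣ bs ∣ even)
... | no  _     = refl
parityBit-unique false bs even with Eeven? ∣ bs ∣
... | yes _   = refl
... | no  odd = contradiction even odd

Eeven·E-zero : (Eeven · E) 0 ↔ ⊤
Eeven·E-zero = mk↔ₛ′ (λ _ → tt) (λ _ → [] , tt , tt) (λ _ → refl) (λ { ([] , tt , tt) → refl })

Eeven·E-suc : ∀ n → (Eeven · E) (suc n) ↔ Subset n
Eeven·E-suc n = mk↔ₛ′ (tail ∘ proj₁) (λ bs → parityBit bs ∷ bs , parityBit-Eeven bs , tt) (λ _ → refl)
  λ { (b ∷ bs , even , tt) → even-subset-≡ (cong (_∷ bs) (parityBit-unique b bs even)) }
  where
  even-subset-≡ : ∀ {S S′ : Subset (suc n)} {p q} → S ≡ S′ →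
                  _≡_ {A = (Eeven · E) (suc n)} (S , p , tt) (S′ , q , tt)
  even-subset-≡ {S} {p = p} {q} refl = cong (λ r → S , r , tt) (Eeven-irrelevant ∣ S ∣ p q)

proposition5p2 : (Cay21 ≅ 𝟏 ⊕ ∫ (E · E)) × (Cay21 ≅ Eeven · E)
proposition5p2 =
  ≅-trans Cay21≅𝟏⊕∫℘ (⊕-cong ≅-refl (∫-cong (≅-sym E·E≅℘))) ,
  ≅-trans Cay21≅𝟏⊕∫℘ (≅-sym Eeven·E≅𝟏⊕∫℘)
  where
  Cay21≅𝟏⊕∫℘ : Cay21 ≅ 𝟏 ⊕ ∫ ℘
  Cay21≅𝟏⊕∫℘ = ≅-𝟏⊕∫ cay21-zero cay21-suc
  Eeven·E≅𝟏⊕∫℘ : Eeven · E ≅ 𝟏 ⊕ ∫ ℘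
  Eeven·E≅𝟏⊕∫℘ = ≅-𝟏⊕∫ Eeven·E-zero Eeven·E-suc
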